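{- Let $(I,C)$ be a hypergraph of agents and contracts whose equipment consists of non-empty-valued Plott choice functions $f_i$ on $C(i)$, $i\in I$. Every stable contract system $S\subseteq C$ is meta-stable.
   Context: Finite agents $I$, finite contracts $C$, each $c\in C$ with nonempty participant set $P(c)\subseteq I$; for $S\subseteq C$, $S(i)=\{s\in S:i\in P(s)\}$. A choice function $f$ on finite $X$ satisfies $f(A)\subseteq A$; it is Plott if $f(A\cup B)=f(f(A)\cup B)$ for all $A,B$, and non-empty-valued if $f(A)\neq\emptyset$ whenever $A\ne\emptyset$. $S$ is stable if (S0) $f_i(S(i))=S(i)$ for all $i$, and (S*) for each $b\in C\setminus S$ some $i\in P(b)$ has $b\notin f_i(S(i)\cup\{b\})$. An element $d$ dominates a set $A$ relative to $f$ if $A=\emptyset$ or there is $a\in A$ with $a\notin f(\{a,d\})$. A contract $d\in C$ dominates $S\subseteq C$ if for every $i\in P(d)$, $d$ dominates $S(i)$ relative to $f_i$. $S$ is meta-stable if no contract of $C$ dominates $S$. -}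

module Defs where

open import Data.Nat using (ℕ)
open import Data.Fin using (Fin)
open import Data.Bool using (_∧_)
open import Data.Vec using (tabulate; lookup)
open import Data.Fin.Subset using (Subset; _∈_; _∉_; _⊆_; _∪_; ⁅_⁆; Nonempty; ⊥)
open import Data.Fin.Subset.Properties using (_∈?_)
open import Data.Product using (Σ; ∃; _×_)
open import Data.Sum using (_⊎_)
open import Relation.Nullary using (¬_; does)
open import Relation.Binary.PropositionalEquality using (_≡_)

-- Agents: Fin m.  Contracts: Fin n.  A hypergraph is a participant map
-- P : Fin n → Subset m with every P c nonempty.
record Hypergraph (m n : ℕ) : Set where
  field
    P        : Fin n → Subset m
    P-nonempty : ∀ c → Nonempty (P c)

Cof : ∀ {m n} → (Fin n → Subset m) → Fin m → Subset n
Cof P i = tabulate (λ c → does (i ∈? P c))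

restrict : ∀ {m n} → (Fin n → Subset m) → Subset n → Fin m → Subset n
restrict P S i = tabulate (λ c → lookup S c ∧ does (i ∈? P c))

-- A choice function on the finite ground set X ⊆ C (given as a subset of
-- the contracts); it is only constrained on subsets of X.
record ChoiceFunction {n : ℕ} (X : Subset n) : Set where
  field
    f     : Subset n → Subset n
    f-sub : ∀ A → A ⊆ X → f A ⊆ A

open ChoiceFunction public

Plott : ∀ {n} {X : Subset n} → ChoiceFunction X → Set
Plott {X = X} ch = ∀ A B → A ⊆ X → B ⊆ X → f ch (A ∪ B) ≡ f ch (f ch A ∪ B)

NonEmptyValued : ∀ {n} {X : Subset n} → ChoiceFunction X → Set
NonEmptyValued {X = X} ch = ∀ A → A ⊆ X → Nonempty A → Nonempty (f ch A)

Equipment : ∀ {m n} → Hypergraph m n → Set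
Equipment {m} H = (i : Fin m) → ChoiceFunction (Cof (Hypergraph.P H) i)

Stable : ∀ {m n} (H : Hypergraph m n) → Equipment H → Subset n → Set
Stable {m} {n} H eq S =
  ((i : Fin m) → f (eq i) (restrict P S i) ≡ restrict P S i)
  × ((b : Fin n) → b ∉ S →
       ∃ λ (i : Fin m) → i ∈ P b × b ∉ f (eq i) (restrict P S i ∪ ⁅ b ⁆))
  where open Hypergraph H

ElemDominates : ∀ {n} {X : Subset n} → ChoiceFunction X → Fin n → Subset n → Set
ElemDominates g d A = A ≡ ⊥ ⊎ ∃ λ a → a ∈ A × a ∉ f g (⁅ a ⁆ ∪ ⁅ d ⁆)

Dominates : ∀ {m n} (H : Hypergraph m n) → Equipment H → Fin n → Subset n → Set
Dominates {m} H eq d S =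
  (i : Fin m) → i ∈ Hypergraph.P H d → ElemDominates (eq i) d (restrict (Hypergraph.P H) S i)

MetaStable : ∀ {m n} (H : Hypergraph m n) → Equipment H → Subset n → Set
MetaStable {n = n} H eq S = (d : Fin n) → ¬ Dominates H eq d S

-- Plott path independence makes every f_i satisfy heritage (a contract chosen from a
-- set stays chosen from any subset containing it) and the outcast property (removing
-- rejected contracts does not change the choice). For a stable S and any contract d
-- there is an agent i ∈ P(d) with f_i(S(i) ∪ {d}) = S(i): if d ∈ S this is S0, and
-- otherwise S* gives an agent rejecting d, after which outcast and S0 apply. At such
-- an agent d cannot dominate S(i): an empty S(i) would make the choice from {d}
-- empty, and a witness a ∈ S(i) with a ∉ f_i({a, d}) contradicts heritage.
module Submission where

open import Defs
open import Data.Nat using (ℕ)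
open import Data.Bool using (Bool; true; _∧_)
open import Data.Fin using (Fin)
open import Data.Fin.Subset
open import Data.Fin.Subset.Properties
open import Data.Vec using (tabulate; lookup)
open import Data.Vec.Properties using (lookup∘tabulate; []=⇒lookup; lookup⇒[]=)
open import Data.Product using (∃; _×_; _,_; proj₂)
open import Data.Sum using (inj₁; inj₂; [_,_]′)
open import Function using (_∘_)
open import Relation.Nullary using (Dec; yes; no; does; ¬_; contradiction)
open import Relation.Nullary.Decidable using (dec-true)
open import Relation.Binary.PropositionalEquality

module _ {n : ℕ} {p q : Subset n} where

  ∪-lub : ∀ {r} → p ⊆ r → q ⊆ r → p ∪ q ⊆ r
  ∪-lub p⊆r q⊆r = [ p⊆r , q⊆r ]′ ∘ x∈p∪q⁻ p q

  q⊆p⇒p∪q≡p : q ⊆ p → p ∪ q ≡ p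
  q⊆p⇒p∪q≡p q⊆p = ⊆-antisym (∪-lub ⊆-refl q⊆p) (p⊆p∪q q)

  p⊆q⇒p∪q≡q : p ⊆ q → p ∪ q ≡ q
  p⊆q⇒p∪q≡q p⊆q = ⊆-antisym (∪-lub p⊆q ⊆-refl) (q⊆p∪q p q)

⁅x⁆⊆p : ∀ {n} {x : Fin n} {p : Subset n} → x ∈ p → ⁅ x ⁆ ⊆ p
⁅x⁆⊆p {x = x} {p} x∈p y∈⁅x⁆ = subst (_∈ p) (sym (x∈⁅y⁆⇒x≡y x y∈⁅x⁆)) x∈p

does-true⇒ : ∀ {A : Set} (a? : Dec A) → does a? ≡ true → A
does-true⇒ (yes a) _ = a

module _ {n : ℕ} {b : Fin n → Bool} {x : Fin n} where

  ∈-tabulate⁺ : b x ≡ true → x ∈ tabulate b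
  ∈-tabulate⁺ bx = lookup⇒[]= x (tabulate b) (trans (lookup∘tabulate b x) bx)

  ∈-tabulate⁻ : x ∈ tabulate b → b x ≡ true
  ∈-tabulate⁻ x∈ = trans (sym (lookup∘tabulate b x)) ([]=⇒lookup x∈)

module _ {m n : ℕ} (P : Fin n → Subset m) {i : Fin m} where

  ∈-Cof⁺ : ∀ {c} → i ∈ P c → c ∈ Cof P i
  ∈-Cof⁺ {c} i∈Pc = ∈-tabulate⁺ (dec-true (i ∈? P c) i∈Pc)

  ∈-restrict⁺ : ∀ {S c} → c ∈ S → i ∈ P c → c ∈ restrict P S i
  ∈-restrict⁺ {S} {c} c∈S i∈Pc =
    ∈-tabulate⁺ (cong₂ _∧_ ([]=⇒lookup c∈S) (dec-true (i ∈? P c) i∈Pc))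

  ∈-restrict⁻ : ∀ {S c} → c ∈ restrict P S i → c ∈ S × i ∈ P c
  ∈-restrict⁻ {S} {c} c∈ with lookup S c in S[c] | ∈-tabulate⁻ c∈
  ... | true | i∈Pc = lookup⇒[]= c S S[c] , does-true⇒ (i ∈? P c) i∈Pc

restrict⊆Cof : ∀ {m n} (P : Fin n → Subset m) S i → restrict P S i ⊆ Cof P i
restrict⊆Cof P S i = ∈-Cof⁺ P {i} ∘ proj₂ ∘ ∈-restrict⁻ P {S = S}

module PlottChoice {n : ℕ} {X : Subset n} (g : ChoiceFunction X) (plott : Plott g) where

  heritage : ∀ {T B a} → T ⊆ X → B ⊆ T → a ∈ B → a ∈ f g T → a ∈ f g B
  heritage {T} {B} {a} T⊆X B⊆T a∈B a∈fT =
    [ (λ a∈fB → a∈fB) , (λ a∈R → contradiction a∈B (x∈∁p⇒x∉p (proj₂ (x∈p∩q⁻ T (∁ B) a∈R)))) ]′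
      (x∈p∪q⁻ (f g B) R (f-sub g (f g B ∪ R) fB∪R⊆X a∈f[fB∪R]))
    where
      R : Subset n
      R = T ∩ ∁ B

      B⊆X : B ⊆ X
      B⊆X = T⊆X ∘ B⊆T

      R⊆X : R ⊆ X
      R⊆X = T⊆X ∘ p∩q⊆p T (∁ B)

      fB∪R⊆X : f g B ∪ R ⊆ X
      fB∪R⊆X = ∪-lub (B⊆X ∘ f-sub g B B⊆X) R⊆X

      T⊆B∪R : T ⊆ B ∪ R
      T⊆B∪R {x} x∈T with x ∈? B
      ... | yes x∈B = p⊆p∪q R x∈B
      ... | no  x∉B = q⊆p∪q B R (x∈p∩q⁺ (x∈T , x∉p⇒x∈∁p x∉B))

      B∪R≡T : B ∪ R ≡ T
      B∪R≡T = ⊆-antisym (∪-lub B⊆T (p∩q⊆p T (∁ B))) T⊆B∪R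

      a∈f[fB∪R] : a ∈ f g (f g B ∪ R)
      a∈f[fB∪R] = subst (a ∈_) (trans (cong (f g) (sym B∪R≡T)) (plott B R B⊆X R⊆X)) a∈fT

  outcast : ∀ {T A} → T ⊆ X → A ⊆ T → f g T ⊆ A → f g T ≡ f g A
  outcast {T} {A} T⊆X A⊆T fT⊆A = begin
    f g T           ≡⟨ cong (f g) (sym (q⊆p⇒p∪q≡p A⊆T)) ⟩
    f g (T ∪ A)     ≡⟨ plott T A T⊆X (T⊆X ∘ A⊆T) ⟩
    f g (f g T ∪ A) ≡⟨ cong (f g) (p⊆q⇒p∪q≡q fT⊆A) ⟩
    f g A           ∎
    where open ≡-Reasoning

  f[A∪d]≡A⇒¬ElemDominates : NonEmptyValued g → ∀ {A d} → A ⊆ X → d ∈ X →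
                             f g (A ∪ ⁅ d ⁆) ≡ A → ¬ ElemDominates g d A
  f[A∪d]≡A⇒¬ElemDominates nonEmpty {A} {d} A⊆X d∈X f[A∪d]≡A (inj₁ A≡⊥) =
    let (x , x∈f[A∪d]) = nonEmpty (A ∪ ⁅ d ⁆) A∪d⊆X (d , q⊆p∪q A ⁅ d ⁆ (x∈⁅x⁆ d))
    in ∉⊥ (subst (x ∈_) (trans f[A∪d]≡A A≡⊥) x∈f[A∪d])
    where
      A∪d⊆X : A ∪ ⁅ d ⁆ ⊆ X
      A∪d⊆X = ∪-lub A⊆X (⁅x⁆⊆p d∈X)
  f[A∪d]≡A⇒¬ElemDominates nonEmpty {A} {d} A⊆X d∈X f[A∪d]≡A (inj₂ (a , a∈A , a∉f[a,d])) =
    a∉f[a,d] (heritage (∪-lub A⊆X (⁅x⁆⊆p d∈X)) pair⊆A∪d (p⊆p∪q ⁅ d ⁆ (x∈⁅x⁆ a))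
                (subst (a ∈_) (sym f[A∪d]≡A) a∈A))
    where
      pair⊆A∪d : ⁅ a ⁆ ∪ ⁅ d ⁆ ⊆ A ∪ ⁅ d ⁆
      pair⊆A∪d = ∪-lub (p⊆p∪q ⁅ d ⁆ ∘ ⁅x⁆⊆p a∈A) (q⊆p∪q A ⁅ d ⁆)

  f[A∪d]≡A-if-∈ : ∀ {A d} → d ∈ A → f g A ≡ A → f g (A ∪ ⁅ d ⁆) ≡ A
  f[A∪d]≡A-if-∈ d∈A fA≡A = trans (cong (f g) (q⊆p⇒p∪q≡p (⁅x⁆⊆p d∈A))) fA≡A

  f[A∪d]≡A-if-rejected : ∀ {A d} → A ⊆ X → d ∈ X → f g A ≡ A →
                         d ∉ f g (A ∪ ⁅ d ⁆) → f g (A ∪ ⁅ d ⁆) ≡ A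
  f[A∪d]≡A-if-rejected {A} {d} A⊆X d∈X fA≡A d∉f[A∪d] =
    trans (outcast A∪d⊆X (p⊆p∪q ⁅ d ⁆) f[A∪d]⊆A) fA≡A
    where
      A∪d⊆X : A ∪ ⁅ d ⁆ ⊆ X
      A∪d⊆X = ∪-lub A⊆X (⁅x⁆⊆p d∈X)

      f[A∪d]⊆A : f g (A ∪ ⁅ d ⁆) ⊆ A
      f[A∪d]⊆A {x} x∈f = [ (λ x∈A → x∈A) , (λ x∈⁅d⁆ → contradiction (x≡d⇒d∈f (x∈⁅y⁆⇒x≡y d x∈⁅d⁆)) d∉f[A∪d]) ]′
        (x∈p∪q⁻ A ⁅ d ⁆ (f-sub g (A ∪ ⁅ d ⁆) A∪d⊆X x∈f))
        where
          x≡d⇒d∈f : x ≡ d → d ∈ f g (A ∪ ⁅ d ⁆)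
          x≡d⇒d∈f refl = x∈f

module _ {m n : ℕ} (H : Hypergraph m n) (eq : Equipment H) where
  open Hypergraph H

  stable⇒agent-keeping-S : ((i : Fin m) → Plott (eq i)) → ∀ {S} → Stable H eq S →
    ∀ d → ∃ λ i → i ∈ P d × f (eq i) (restrict P S i ∪ ⁅ d ⁆) ≡ restrict P S i
  stable⇒agent-keeping-S plott {S} (S0 , S*) d with d ∈? S
  ... | yes d∈S =
    let (i , i∈Pd) = P-nonempty d
    in i , i∈Pd , PlottChoice.f[A∪d]≡A-if-∈ (eq i) (plott i) (∈-restrict⁺ P d∈S i∈Pd) (S0 i)
  ... | no d∉S =
    let (i , i∈Pd , d∉f) = S* d d∉S
    in i , i∈Pd , PlottChoice.f[A∪d]≡A-if-rejected (eq i) (plott i)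
                    (restrict⊆Cof P S i) (∈-Cof⁺ P i∈Pd) (S0 i) d∉f

proposition4p1 : ∀ {m n : ℕ} (H : Hypergraph m n) (eq : Equipment H) →
    ((i : Fin m) → NonEmptyValued (eq i)) →
    ((i : Fin m) → Plott (eq i)) →
    (S : Subset n) → Stable H eq S → MetaStable H eq S
proposition4p1 H eq nonEmpty plott S stable d d-dominates =
  let (i , i∈Pd , keeps-S) = stable⇒agent-keeping-S H eq plott stable d
  in PlottChoice.f[A∪d]≡A⇒¬ElemDominates (eq i) (plott i) (nonEmpty i)
       (restrict⊆Cof P S i) (∈-Cof⁺ P i∈Pd) keeps-S (d-dominates i i∈Pd)
  where open Hypergraph H
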